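{- Let $n$ be a non-negative integer and let $f(0),\dots,f(n)$ and $g(0),\dots,g(n)$ be complex numbers such that, for all complex $x$, \[ \sum_{k=0}^n f(k)x^k=\sum_{k=0}^n g(k)(1-x)^k. \] Then for every non-negative integer $m$, \begin{align*} \sum_{k=0}^n k^m f(k) &= \sum_{k=0}^{\min(m,n)}(-1)^k k!\left\{{m\atop k}\right\}g(k),\\ \sum_{k=0}^n k^m g(k) &= \sum_{k=0}^{\min(m,n)}(-1)^k k!\left\{{m\atop k}\right\}f(k),\\ \sum_{k=0}^n k^m f(n-k) &= \sum_{k=0}^{\min(m,n)} k!\left\{{n+m-k\atop n}\right\}_{n-k}g(k),\\ \sum_{k=0}^n k^m g(n-k) &= \sum_{k=0}^{\min(m,n)} k!\left\{{n+m-k\atop n}\right\}_{n-k}f(k). \end{align*}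
   Context: $\left\{{m\atop k}\right\}=\frac1{k!}\sum_{p=0}^k(-1)^{k-p}\binom kp p^m$ is the Stirling number of the second kind (with $0^0=1$; it vanishes for $k>m$). For non-negative integers $u,v,m$, the $v$-Stirling number of the second kind is $\left\{{m+v\atop u+v}\right\}_v=\frac1{u!}\sum_{p=0}^u(-1)^{u-p}\binom up(v+p)^m$; thus $\left\{{n+m-k\atop n}\right\}_{n-k}=\frac1{k!}\sum_{p=0}^k(-1)^{k-p}\binom kp(n-k+p)^m$. -}

module Defs where

open import Level using (Level)
open import Data.Nat as ℕ using (ℕ; zero; suc; _∸_; _!)
open import Data.Nat.Properties using (_!≢0)
open import Data.Nat.Combinatorics using (_C_)
open import Data.Integer as ℤ using (ℤ; +_; -[1+_])
open import Data.Integer.DivMod using (_/ℕ_)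
open import Data.Empty using (⊥)
open import Data.Sum using (_⊎_)
open import Relation.Nullary using (¬_)
open import Algebra.Bundles using (CommutativeRing)

ℤsum : ℕ → (ℕ → ℤ) → ℤ
ℤsum zero    h = h 0
ℤsum (suc k) h = ℤsum k h ℤ.+ h (suc k)

sgn : ℕ → ℤ
sgn zero    = + 1
sgn (suc j) = ℤ.- sgn j

stirling2 : ℕ → ℕ → ℤ
stirling2 m k =
  _/ℕ_ (ℤsum k (λ p → sgn (k ∸ p) ℤ.* (+ (k C p)) ℤ.* (+ (p ℕ.^ m))))
       (k !) {{k !≢0}}

-- v-Stirling number of the second kind, as in the paper:
-- vStirling2 v u m = {m+v  u+v}_v = (1/u!) Σ_{p=0}^{u} (-1)^{u-p} C(u,p) (v+p)^m
vStirling2 : ℕ → ℕ → ℕ → ℤ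
vStirling2 v u m =
  _/ℕ_ (ℤsum u (λ p → sgn (u ∸ p) ℤ.* (+ (u C p)) ℤ.* (+ ((v ℕ.+ p) ℕ.^ m))))
       (u !) {{u !≢0}}

module _ {c ℓ : Level} (R : CommutativeRing c ℓ) where
  open CommutativeRing R

  rpow : Carrier → ℕ → Carrier
  rpow x zero    = 1#
  rpow x (suc k) = x * rpow x k

  natR : ℕ → Carrier
  natR zero    = 0#
  natR (suc n) = 1# + natR n

  rsum : ℕ → (ℕ → Carrier) → Carrier
  rsum zero    h = h 0
  rsum (suc n) h = rsum n h + h (suc n)

  ιℤ : ℤ → Carrier
  ιℤ (+ n)      = natR n
  ιℤ -[1+ n ]   = - (natR (suc n))

  IsIntegralDomain : Set (c Level.⊔ ℓ)
  IsIntegralDomain = ∀ x y → x * y ≈ 0# → x ≈ 0# ⊎ y ≈ 0#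

  HasCharZero : Set ℓ
  HasCharZero = ∀ n → ¬ (natR (suc n) ≈ 0#)

{-# OPTIONS --safe #-}
module Submission where

-- The n-th forward difference at 0 of Σₖ₌₀ⁿ a(k) xᵏ is n!·a(n), so in an integral
-- domain of characteristic 0 a polynomial vanishing at all of 0, 1, 2, … has zero
-- coefficients. Expanding (1-x)ʲ, the hypothesis therefore says
-- f(k) = Σⱼ (-1)ᵏ C(j,k) g(j), hence Σₖ u(k) f(k) = Σⱼ g(j) Σₖ (-1)ᵏ C(j,k) u(k).
-- By Newton's forward-difference formula the inner sum is (-1)ʲ Δʲu(0), resp.
-- Δʲh(n-j) when u(k) = h(n-k). For h(x) = xᵐ these differences are
-- j!·{m+v, j+v}_v with v = 0 resp. v = n-j, and they vanish for j > m.
-- The substitution x ↦ 1-x exchanges f and g.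

open import Defs
open import Level using (Level)
open import Data.Empty using (⊥-elim)
open import Data.Maybe using (Maybe; just; nothing)
open import Relation.Nullary using (¬_; yes; no)
open import Data.Nat using (ℕ; zero; suc; _∸_; _!; _⊓_; _≤_; _<_; z≤n; s≤s)
import Data.Nat as ℕ
open import Data.Nat.Properties as ℕₚ using (_!≢0)
open import Data.Nat.Combinatorics using (_C_; nCk+nC[k+1]≡[n+1]C[k+1]; k>n⇒nCk≡0; nCk≡nC[n∸k])
open import Data.Nat.DivMod using (m*n/n≡m)
open import Data.Nat.Tactic.RingSolver using (solve-∀)
open import Data.Integer as ℤ using (ℤ; +_; -[1+_])
import Data.Integer.Properties as ℤₚ
open import Data.Product using (_×_; _,_)
open import Data.Sum using (inj₁; inj₂)
open import Relation.Binary.PropositionalEquality as ≡ using (_≡_)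
open import Algebra.Bundles using (CommutativeRing)
import Algebra.Solver.Ring.AlmostCommutativeRing as ACR
import Algebra.Solver.Ring as RingSolver

-- vStirling v k m = {m+v, k+v}_v, computed by the standard recurrence
-- {m+1+v, k+v}_v = (k+v) {m+v, k+v}_v + {m+v, k-1+v}_v.
vStirling : ℕ → ℕ → ℕ → ℕ
vStirling v zero    zero    = 1
vStirling v (suc k) zero    = 0
vStirling v zero    (suc m) = v ℕ.* vStirling v zero m
vStirling v (suc k) (suc m) = (v ℕ.+ suc k) ℕ.* vStirling v (suc k) m ℕ.+ vStirling v k m

vStirling-zero : ∀ v m → vStirling v 0 m ≡ v ℕ.^ m
vStirling-zero v zero    = ≡.refl
vStirling-zero v (suc m) = ≡.cong (v ℕ.*_) (vStirling-zero v m)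

vStirling-vanishes : ∀ v {k m} → m < k → vStirling v k m ≡ 0
vStirling-vanishes v {suc k} {zero}  _ = ≡.refl
vStirling-vanishes v {suc k} {suc m} (s≤s m<k)
  rewrite vStirling-vanishes v {suc k} {m} (ℕₚ.m<n⇒m<1+n m<k) | vStirling-vanishes v m<k
  = ≡.trans (ℕₚ.+-identityʳ _) (ℕₚ.*-zeroʳ (v ℕ.+ suc k))

vStirling-diagonal : ∀ v k → vStirling v k k ≡ 1
vStirling-diagonal v zero = ≡.refl
vStirling-diagonal v (suc k)
  rewrite vStirling-vanishes v {suc k} {k} (ℕₚ.n<1+n k) | vStirling-diagonal v k
  = ≡.cong (ℕ._+ 1) (ℕₚ.*-zeroʳ (v ℕ.+ suc k))

m∸[n∸o]≡m∸n+o : ∀ {m n o} → o ≤ n → n ≤ m → m ∸ (n ∸ o) ≡ m ∸ n ℕ.+ o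
m∸[n∸o]≡m∸n+o {m} {n} {o} o≤n n≤m = begin
  m ∸ (n ∸ o)               ≡⟨ ≡.cong (_∸ (n ∸ o)) (ℕₚ.m∸n+n≡m n≤m) ⟨
  (m ∸ n ℕ.+ n) ∸ (n ∸ o)   ≡⟨ ℕₚ.+-∸-assoc (m ∸ n) (ℕₚ.m∸n≤m n o) ⟩
  m ∸ n ℕ.+ (n ∸ (n ∸ o))   ≡⟨ ≡.cong (m ∸ n ℕ.+_) (ℕₚ.m∸[m∸n]≡n o≤n) ⟩
  m ∸ n ℕ.+ o               ∎
  where open ≡.≡-Reasoning

module CommutativeRingLemmas {c ℓ : Level} (R : CommutativeRing c ℓ) where
  open CommutativeRing R
  open import Algebra.Properties.Ring ring
  open import Relation.Binary.Reasoning.Setoid setoid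

  nat : ℕ → Carrier
  nat = natR R

  ι : ℤ → Carrier
  ι = ιℤ R

  infixr 8 _^_
  _^_ : Carrier → ℕ → Carrier
  _^_ = rpow R

  Σ : ℕ → (ℕ → Carrier) → Carrier
  Σ = rsum R

  nat-+ : ∀ a b → nat (a ℕ.+ b) ≈ nat a + nat b
  nat-+ zero    b = sym (+-identityˡ _)
  nat-+ (suc a) b = trans (+-congˡ (nat-+ a b)) (sym (+-assoc _ _ _))

  nat-* : ∀ a b → nat (a ℕ.* b) ≈ nat a * nat b
  nat-* zero    b = sym (zeroˡ _)
  nat-* (suc a) b = begin
    nat (b ℕ.+ a ℕ.* b)          ≈⟨ nat-+ b (a ℕ.* b) ⟩
    nat b + nat (a ℕ.* b)        ≈⟨ +-cong (sym (*-identityˡ _)) (nat-* a b) ⟩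
    1# * nat b + nat a * nat b   ≈⟨ sym (distribʳ _ _ _) ⟩
    (1# + nat a) * nat b         ∎

  ι-⊖ : ∀ m n → ι (m ℤ.⊖ n) ≈ nat m - nat n
  ι-⊖ m       zero    = begin
    ι (m ℤ.⊖ 0)     ≡⟨ ≡.cong ι (ℤₚ.⊖-≥ {m} {0} z≤n) ⟩
    nat m           ≈⟨ +-identityʳ _ ⟨
    nat m + 0#      ≈⟨ +-congˡ -0#≈0# ⟨
    nat m - 0#      ∎
  ι-⊖ zero    (suc n) = begin
    ι (0 ℤ.⊖ suc n)  ≡⟨ ≡.cong ι (ℤₚ.⊖-≤ {0} {suc n} z≤n) ⟩
    - nat (suc n)    ≈⟨ +-identityˡ _ ⟨
    0# - nat (suc n) ∎
  ι-⊖ (suc m) (suc n) = begin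
    ι (suc m ℤ.⊖ suc n)                 ≡⟨ ≡.cong ι (ℤₚ.[1+m]⊖[1+n]≡m⊖n m n) ⟩
    ι (m ℤ.⊖ n)                         ≈⟨ ι-⊖ m n ⟩
    nat m - nat n                       ≈⟨ +-identityˡ _ ⟨
    0# + (nat m - nat n)                ≈⟨ +-congʳ (-‿inverseʳ 1#) ⟨
    1# - 1# + (nat m - nat n)           ≈⟨ +-assoc _ _ _ ⟩
    1# + (- 1# + (nat m - nat n))       ≈⟨ +-congˡ (+-congˡ (+-comm _ _)) ⟩
    1# + (- 1# + (- nat n + nat m))     ≈⟨ +-congˡ (+-assoc _ _ _) ⟨
    1# + ((- 1# - nat n) + nat m)       ≈⟨ +-congˡ (+-comm _ _) ⟩
    1# + (nat m + (- 1# - nat n))       ≈⟨ +-assoc _ _ _ ⟨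
    (1# + nat m) + (- 1# - nat n)       ≈⟨ +-congˡ (-‿+-comm _ _) ⟩
    (1# + nat m) - (1# + nat n)         ∎

  ι-+ : ∀ a b → ι (a ℤ.+ b) ≈ ι a + ι b
  ι-+ (+ m)    (+ n)    = nat-+ m n
  ι-+ (+ m)    -[1+ n ] = ι-⊖ m (suc n)
  ι-+ -[1+ m ] (+ n)    = trans (ι-⊖ n (suc m)) (+-comm _ _)
  ι-+ -[1+ m ] -[1+ n ] = begin
    - nat (suc (suc (m ℕ.+ n)))      ≡⟨ ≡.cong (λ k → - nat (suc k)) (≡.sym (ℕₚ.+-suc m n)) ⟩
    - nat (suc m ℕ.+ suc n)          ≈⟨ -‿cong (nat-+ (suc m) (suc n)) ⟩
    - (nat (suc m) + nat (suc n))    ≈⟨ -‿+-comm _ _ ⟨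
    - nat (suc m) + - nat (suc n)    ∎

  ι-neg : ∀ a → ι (ℤ.- a) ≈ - ι a
  ι-neg (+ zero)  = sym -0#≈0#
  ι-neg (+ suc n) = refl
  ι-neg -[1+ n ]  = sym (-‿involutive _)

  ι-+* : ∀ m b → ι (+ m ℤ.* b) ≈ nat m * ι b
  ι-+* m (+ n)    = trans (reflexive (≡.cong ι (≡.sym (ℤₚ.pos-* m n)))) (nat-* m n)
  ι-+* m -[1+ n ] = begin
    ι (+ m ℤ.* ℤ.- + suc n)       ≡⟨ ≡.cong ι (≡.sym (ℤₚ.neg-distribʳ-* (+ m) (+ suc n))) ⟩
    ι (ℤ.- (+ m ℤ.* + suc n))     ≈⟨ ι-neg (+ m ℤ.* + suc n) ⟩
    - ι (+ m ℤ.* + suc n)         ≈⟨ -‿cong (ι-+* m (+ suc n)) ⟩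
    - (nat m * nat (suc n))       ≈⟨ -‿distribʳ-* _ _ ⟩
    nat m * - nat (suc n)         ∎

  ι-* : ∀ a b → ι (a ℤ.* b) ≈ ι a * ι b
  ι-* (+ m)    b = ι-+* m b
  ι-* -[1+ m ] b = begin
    ι (ℤ.- + suc m ℤ.* b)         ≡⟨ ≡.cong ι (≡.sym (ℤₚ.neg-distribˡ-* (+ suc m) b)) ⟩
    ι (ℤ.- (+ suc m ℤ.* b))       ≈⟨ ι-neg (+ suc m ℤ.* b) ⟩
    - ι (+ suc m ℤ.* b)           ≈⟨ -‿cong (ι-+* (suc m) b) ⟩
    - (nat (suc m) * ι b)         ≈⟨ -‿distribˡ-* _ _ ⟩
    - nat (suc m) * ι b           ∎

  private
    almostCommutativeRing = ACR.fromCommutativeRing R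

    ι-homomorphism : ACR._-Raw-AlmostCommutative⟶_
      (CommutativeRing.rawRing ℤₚ.+-*-commutativeRing) almostCommutativeRing
    ι-homomorphism = record
      { ⟦_⟧ = ι ; +-homo = ι-+ ; *-homo = ι-* ; -‿homo = ι-neg ; 0-homo = refl ; 1-homo = +-identityʳ 1# }

    ι-≟ : ∀ a b → Maybe (ι a ≈ ι b)
    ι-≟ a b with a ℤ.≟ b
    ... | yes a≡b = just (reflexive (≡.cong ι a≡b))
    ... | no _    = nothing

  open RingSolver (CommutativeRing.rawRing ℤₚ.+-*-commutativeRing) almostCommutativeRing ι-homomorphism ι-≟
    using (solve; _:=_; _:+_; _:*_; :-_; _:-_)

  ^-cong : ∀ {x y} k → x ≈ y → x ^ k ≈ y ^ k
  ^-cong zero    _   = refl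
  ^-cong (suc k) x≈y = *-cong x≈y (^-cong k x≈y)

  nat-^ : ∀ i k → nat i ^ k ≈ nat (i ℕ.^ k)
  nat-^ i zero    = sym (+-identityʳ _)
  nat-^ i (suc k) = trans (*-congˡ (nat-^ i k)) (sym (nat-* i (i ℕ.^ k)))

  sign : ℕ → Carrier
  sign zero    = 1#
  sign (suc j) = - sign j

  sign-+ : ∀ a b → sign (a ℕ.+ b) ≈ sign a * sign b
  sign-+ zero    b = sym (*-identityˡ _)
  sign-+ (suc a) b = trans (-‿cong (sign-+ a b)) (-‿distribˡ-* _ _)

  sign-square : ∀ a → sign a * sign a ≈ 1#
  sign-square zero    = *-identityˡ _
  sign-square (suc a) = trans (solve 1 (λ s → (:- s) :* (:- s) := s :* s) refl (sign a)) (sign-square a)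

  sign-∸ : ∀ {k j} → k ≤ j → sign j * sign (j ∸ k) ≈ sign k
  sign-∸ {k} {j} k≤j = begin
    sign j * sign (j ∸ k)                   ≡⟨ ≡.cong (λ t → sign t * sign (j ∸ k)) (ℕₚ.m+[n∸m]≡n k≤j) ⟨
    sign (k ℕ.+ (j ∸ k)) * sign (j ∸ k)     ≈⟨ *-congʳ (sign-+ k (j ∸ k)) ⟩
    sign k * sign (j ∸ k) * sign (j ∸ k)    ≈⟨ *-assoc _ _ _ ⟩
    sign k * (sign (j ∸ k) * sign (j ∸ k))  ≈⟨ *-congˡ (sign-square (j ∸ k)) ⟩
    sign k * 1#                             ≈⟨ *-identityʳ _ ⟩
    sign k                                  ∎

  ι-sgn : ∀ j → ι (sgn j) ≈ sign j
  ι-sgn zero    = +-identityʳ _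
  ι-sgn (suc j) = trans (ι-neg (sgn j)) (-‿cong (ι-sgn j))

  -‿^ : ∀ x j → (- x) ^ j ≈ sign j * x ^ j
  -‿^ x zero    = sym (*-identityˡ _)
  -‿^ x (suc j) = trans (*-congˡ (-‿^ x j))
    (solve 3 (λ x s y → (:- x) :* (s :* y) := (:- s) :* (x :* y)) refl x (sign j) (x ^ j))

  Σ-cong : ∀ n {h h′ : ℕ → Carrier} → (∀ k → k ≤ n → h k ≈ h′ k) → Σ n h ≈ Σ n h′
  Σ-cong zero    eq = eq 0 z≤n
  Σ-cong (suc n) eq = +-cong (Σ-cong n (λ k k≤n → eq k (ℕₚ.m≤n⇒m≤1+n k≤n))) (eq (suc n) ℕₚ.≤-refl)

  Σ-zero : ∀ n {h : ℕ → Carrier} → (∀ k → k ≤ n → h k ≈ 0#) → Σ n h ≈ 0#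
  Σ-zero zero    h≈0 = h≈0 0 z≤n
  Σ-zero (suc n) h≈0 =
    trans (+-cong (Σ-zero n (λ k k≤n → h≈0 k (ℕₚ.m≤n⇒m≤1+n k≤n))) (h≈0 (suc n) ℕₚ.≤-refl)) (+-identityʳ 0#)

  Σ-distrib-+ : ∀ n (h h′ : ℕ → Carrier) → Σ n (λ k → h k + h′ k) ≈ Σ n h + Σ n h′
  Σ-distrib-+ zero    h h′ = refl
  Σ-distrib-+ (suc n) h h′ = trans (+-congʳ (Σ-distrib-+ n h h′))
    (solve 4 (λ a b c d → (a :+ b) :+ (c :+ d) := (a :+ c) :+ (b :+ d)) refl _ _ _ _)

  -‿distrib-Σ : ∀ n (h : ℕ → Carrier) → - Σ n h ≈ Σ n (λ k → - h k)
  -‿distrib-Σ zero    h = refl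
  -‿distrib-Σ (suc n) h = trans (sym (-‿+-comm _ _)) (+-congʳ (-‿distrib-Σ n h))

  Σ-distrib-sub : ∀ n (h h′ : ℕ → Carrier) → Σ n (λ k → h k - h′ k) ≈ Σ n h - Σ n h′
  Σ-distrib-sub n h h′ = trans (Σ-distrib-+ n h _) (+-congˡ (sym (-‿distrib-Σ n h′)))

  *-distribˡ-Σ : ∀ n a (h : ℕ → Carrier) → a * Σ n h ≈ Σ n (λ k → a * h k)
  *-distribˡ-Σ zero    a h = refl
  *-distribˡ-Σ (suc n) a h = trans (distribˡ _ _ _) (+-congʳ (*-distribˡ-Σ n a h))

  *-distribʳ-Σ : ∀ n a (h : ℕ → Carrier) → Σ n h * a ≈ Σ n (λ k → h k * a)
  *-distribʳ-Σ zero    a h = refl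
  *-distribʳ-Σ (suc n) a h = trans (distribʳ _ _ _) (+-congʳ (*-distribʳ-Σ n a h))

  Σ-unfoldˡ : ∀ n (h : ℕ → Carrier) → Σ (suc n) h ≈ h 0 + Σ n (λ k → h (suc k))
  Σ-unfoldˡ zero    h = refl
  Σ-unfoldˡ (suc n) h = trans (+-congʳ (Σ-unfoldˡ n h)) (+-assoc _ _ _)

  Σ-comm : ∀ n m (h : ℕ → ℕ → Carrier) → Σ n (λ i → Σ m (h i)) ≈ Σ m (λ j → Σ n (λ i → h i j))
  Σ-comm zero    m h = refl
  Σ-comm (suc n) m h = trans (+-congʳ (Σ-comm n m h)) (sym (Σ-distrib-+ m _ _))

  Σ-reverse : ∀ n (h : ℕ → Carrier) → Σ n h ≈ Σ n (λ k → h (n ∸ k))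
  Σ-reverse zero    h = refl
  Σ-reverse (suc n) h = begin
    Σ n h + h (suc n)                      ≈⟨ +-congʳ (Σ-reverse n h) ⟩
    Σ n (λ k → h (n ∸ k)) + h (suc n)      ≈⟨ +-comm _ _ ⟩
    h (suc n) + Σ n (λ k → h (n ∸ k))      ≈⟨ Σ-unfoldˡ n (λ k → h (suc n ∸ k)) ⟨
    Σ (suc n) (λ k → h (suc n ∸ k))        ∎

  Σ-shrink : ∀ {m} n (h : ℕ → Carrier) → m ≤ n → (∀ k → m < k → h k ≈ 0#) → Σ n h ≈ Σ m h
  Σ-shrink zero    h z≤n     _   = refl
  Σ-shrink (suc n) h m≤1+n   h≈0 with ℕₚ.m≤n⇒m<n∨m≡n m≤1+n
  ... | inj₂ ≡.refl      = refl
  ... | inj₁ (s≤s m≤n) = trans (+-cong (Σ-shrink n h m≤n h≈0) (h≈0 (suc n) (s≤s m≤n))) (+-identityʳ _)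

  Σ-⊓ : ∀ m n (h : ℕ → Carrier) → (∀ k → m < k → h k ≈ 0#) → Σ n h ≈ Σ (m ⊓ n) h
  Σ-⊓ m n h h≈0 with ℕₚ.≤-total m n
  ... | inj₁ m≤n rewrite ℕₚ.m≤n⇒m⊓n≡m m≤n = Σ-shrink n h m≤n h≈0
  ... | inj₂ n≤m rewrite ℕₚ.m≥n⇒m⊓n≡n n≤m = refl

  Σ-last : ∀ n (h : ℕ → Carrier) → (∀ k → k < n → h k ≈ 0#) → Σ n h ≈ h n
  Σ-last zero    h _   = refl
  Σ-last (suc n) h h≈0 = trans (+-congʳ (Σ-zero n (λ k k≤n → h≈0 k (s≤s k≤n)))) (+-identityˡ _)

  binomial-vanishes : ∀ {j k} a → j < k → nat (j C k) * a ≈ 0#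
  binomial-vanishes {j} {k} a j<k = trans (*-congʳ (reflexive (≡.cong nat (k>n⇒nCk≡0 j<k)))) (zeroˡ a)

  Σ-pascal : ∀ k (s : ℕ → Carrier) →
    Σ (suc k) (λ p → nat (suc k C p) * s p) ≈
    Σ k (λ p → nat (k C p) * s (suc p)) + Σ k (λ p → nat (k C p) * s p)
  Σ-pascal k s = begin
    Σ (suc k) (λ p → nat (suc k C p) * s p)
      ≈⟨ Σ-unfoldˡ k _ ⟩
    s₀ + Σ k (λ p → nat (suc k C suc p) * s (suc p))
      ≈⟨ +-congˡ (trans (Σ-cong k (λ p _ → pascal p)) (Σ-distrib-+ k _ _)) ⟩
    s₀ + (Σ k (λ p → nat (k C p) * s (suc p)) + Σ k (λ p → nat (k C suc p) * s (suc p)))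
      ≈⟨ solve 3 (λ a b c → a :+ (b :+ c) := b :+ (a :+ c)) refl _ _ _ ⟩
    Σ k (λ p → nat (k C p) * s (suc p)) + (s₀ + Σ k (λ p → nat (k C suc p) * s (suc p)))
      ≈⟨ +-congˡ (Σ-unfoldˡ k (λ p → nat (k C p) * s p)) ⟨
    Σ k (λ p → nat (k C p) * s (suc p)) + Σ (suc k) (λ p → nat (k C p) * s p)
      ≈⟨ +-congˡ (Σ-shrink (suc k) _ (ℕₚ.n≤1+n k) (λ p k<p → binomial-vanishes (s p) k<p)) ⟩
    Σ k (λ p → nat (k C p) * s (suc p)) + Σ k (λ p → nat (k C p) * s p) ∎
    where
    s₀ = nat 1 * s 0
    pascal : ∀ p → nat (suc k C suc p) * s (suc p) ≈ nat (k C p) * s (suc p) + nat (k C suc p) * s (suc p)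
    pascal p = begin
      nat (suc k C suc p) * s (suc p)
        ≡⟨ ≡.cong (λ t → nat t * s (suc p)) (nCk+nC[k+1]≡[n+1]C[k+1] k p) ⟨
      nat (k C p ℕ.+ k C suc p) * s (suc p)            ≈⟨ *-congʳ (nat-+ (k C p) (k C suc p)) ⟩
      (nat (k C p) + nat (k C suc p)) * s (suc p)      ≈⟨ distribʳ _ _ _ ⟩
      nat (k C p) * s (suc p) + nat (k C suc p) * s (suc p) ∎

  Δ : ℕ → (ℕ → Carrier) → ℕ → Carrier
  Δ zero    h v = h v
  Δ (suc k) h v = Δ k h (suc v) - Δ k h v

  Δ-cong : ∀ k {h h′ : ℕ → Carrier} → (∀ x → h x ≈ h′ x) → ∀ v → Δ k h v ≈ Δ k h′ v
  Δ-cong zero    h≈h′ v = h≈h′ v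
  Δ-cong (suc k) h≈h′ v = +-cong (Δ-cong k h≈h′ (suc v)) (-‿cong (Δ-cong k h≈h′ v))

  Δ-const : ∀ k a v → Δ (suc k) (λ _ → a) v ≈ 0#
  Δ-const zero    a v = -‿inverseʳ a
  Δ-const (suc k) a v = trans (+-cong (Δ-const k a (suc v)) (-‿cong (Δ-const k a v))) (-‿inverseʳ 0#)

  Δ-zero : ∀ k {h : ℕ → Carrier} → (∀ x → h x ≈ 0#) → ∀ v → Δ k h v ≈ 0#
  Δ-zero zero    h≈0 v = h≈0 v
  Δ-zero (suc k) h≈0 v = trans (Δ-cong (suc k) h≈0 v) (Δ-const k 0# v)

  Δ-linear : ∀ k n (a : ℕ → Carrier) (h : ℕ → ℕ → Carrier) v →
    Δ k (λ x → Σ n (λ j → a j * h j x)) v ≈ Σ n (λ j → a j * Δ k (h j) v)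
  Δ-linear zero    n a h v = refl
  Δ-linear (suc k) n a h v = begin
    Δ k F (suc v) - Δ k F v
      ≈⟨ +-cong (Δ-linear k n a h (suc v)) (-‿cong (Δ-linear k n a h v)) ⟩
    Σ n (λ j → a j * Δ k (h j) (suc v)) - Σ n (λ j → a j * Δ k (h j) v)
      ≈⟨ Σ-distrib-sub n _ _ ⟨
    Σ n (λ j → a j * Δ k (h j) (suc v) - a j * Δ k (h j) v)
      ≈⟨ Σ-cong n (λ j _ → x[y-z]≈xy-xz (a j) _ _) ⟨
    Σ n (λ j → a j * Δ (suc k) (h j) v) ∎
    where F = λ x → Σ n (λ j → a j * h j x)

  Δ-newton : ∀ k (h : ℕ → Carrier) v → Δ k h v ≈ Σ k (λ p → nat (k C p) * (sign (k ∸ p) * h (v ℕ.+ p)))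
  Δ-newton zero    h v = begin
    h v                          ≡⟨ ≡.cong h (ℕₚ.+-identityʳ v) ⟨
    h (v ℕ.+ 0)                  ≈⟨ *-identityˡ _ ⟨
    1# * h (v ℕ.+ 0)             ≈⟨ *-cong (+-identityʳ 1#) (*-identityˡ _) ⟨
    nat 1 * (1# * h (v ℕ.+ 0))   ∎
  Δ-newton (suc k) h v = begin
    Δ k h (suc v) - Δ k h v
      ≈⟨ +-cong (Δ-newton k h (suc v)) (-‿cong (Δ-newton k h v)) ⟩
    Σ k (term (suc v)) - Σ k (term v)
      ≈⟨ +-cong (Σ-cong k (λ p _ → shift p)) (trans (-‿distrib-Σ k (term v)) (Σ-cong k negate)) ⟩
    Σ k (λ p → nat (k C p) * s (suc p)) + Σ k (λ p → nat (k C p) * s p)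
      ≈⟨ Σ-pascal k s ⟨
    Σ (suc k) (λ p → nat (suc k C p) * s p) ∎
    where
    term : ℕ → ℕ → Carrier
    term w p = nat (k C p) * (sign (k ∸ p) * h (w ℕ.+ p))
    s : ℕ → Carrier
    s p = sign (suc k ∸ p) * h (v ℕ.+ p)
    shift : ∀ p → term (suc v) p ≈ nat (k C p) * s (suc p)
    shift p = reflexive (≡.cong (λ t → nat (k C p) * (sign (k ∸ p) * h t)) (≡.sym (ℕₚ.+-suc v p)))
    negate : ∀ p → p ≤ k → - term v p ≈ nat (k C p) * s p
    negate p p≤k = begin
      - (nat (k C p) * (sign (k ∸ p) * h (v ℕ.+ p)))   ≈⟨ -‿distribʳ-* _ _ ⟩
      nat (k C p) * - (sign (k ∸ p) * h (v ℕ.+ p))     ≈⟨ *-congˡ (-‿distribˡ-* _ _) ⟩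
      nat (k C p) * (sign (suc (k ∸ p)) * h (v ℕ.+ p))
        ≡⟨ ≡.cong (λ t → nat (k C p) * (sign t * h (v ℕ.+ p))) (ℕₚ.+-∸-assoc 1 p≤k) ⟨
      nat (k C p) * s p                                ∎

  Δ-leibniz : ∀ k (h : ℕ → Carrier) v →
    Δ (suc k) (λ x → nat x * h x) v ≈ nat (v ℕ.+ suc k) * Δ (suc k) h v + nat (suc k) * Δ k h v
  Δ-leibniz zero    h v = begin
    nat (suc v) * h (suc v) - nat v * h v
      ≈⟨ solve 4 (λ o N a b → (o :+ N) :* a :- N :* b := (N :+ o) :* (a :- b) :+ o :* b) refl 1# (nat v) _ _ ⟩
    (nat v + 1#) * Δ 1 h v + 1# * h v
      ≈⟨ +-cong (*-congʳ (trans (nat-+ v 1) (+-congˡ (+-identityʳ 1#)))) (*-congʳ (+-identityʳ 1#)) ⟨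
    nat (v ℕ.+ 1) * Δ 1 h v + nat 1 * h v ∎
  Δ-leibniz (suc k) h v = begin
    Δ (suc k) G (suc v) - Δ (suc k) G v
      ≈⟨ +-cong (Δ-leibniz k h (suc v)) (-‿cong (Δ-leibniz k h v)) ⟩
    -- Δ (suc k) h v unfolds to C′ - D, which is what lets the solver close the step.
    (nat (suc v ℕ.+ suc k) * A + K * C′) - (M * (C′ - D) + K * D)
      ≈⟨ solve 6 (λ o M K A C′ D → ((o :+ M) :* A :+ K :* C′) :- (M :* (C′ :- D) :+ K :* D)
                                 := (o :+ M) :* (A :- (C′ :- D)) :+ (o :+ K) :* (C′ :- D))
               refl 1# M K A C′ D ⟩
    (1# + M) * Δ (suc (suc k)) h v + nat (suc (suc k)) * Δ (suc k) h v
      ≡⟨ ≡.cong (λ t → nat t * Δ (suc (suc k)) h v + nat (suc (suc k)) * Δ (suc k) h v) (ℕₚ.+-suc v (suc k)) ⟨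
    nat (v ℕ.+ suc (suc k)) * Δ (suc (suc k)) h v + nat (suc (suc k)) * Δ (suc k) h v ∎
    where
    G = λ x → nat x * h x
    M = nat (v ℕ.+ suc k)
    K = nat (suc k)
    A = Δ (suc k) h (suc v)
    C′ = Δ k h (suc v)
    D = Δ k h v

  Δ-pow : ∀ m k v → Δ k (λ x → nat (x ℕ.^ m)) v ≈ nat (k ! ℕ.* vStirling v k m)
  Δ-pow zero    zero    v = refl
  Δ-pow zero    (suc k) v = trans (Δ-const k (nat 1) v) (reflexive (≡.cong nat (≡.sym (ℕₚ.*-zeroʳ (suc k !)))))
  Δ-pow (suc m) zero    v = reflexive (≡.cong nat (≡.sym (≡.trans (ℕₚ.*-identityˡ _) (vStirling-zero v (suc m)))))
  Δ-pow (suc m) (suc k) v = begin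
    Δ (suc k) (λ x → nat (x ℕ.* x ℕ.^ m)) v
      ≈⟨ Δ-cong (suc k) (λ x → nat-* x (x ℕ.^ m)) v ⟩
    Δ (suc k) (λ x → nat x * P x) v
      ≈⟨ Δ-leibniz k P v ⟩
    nat (v ℕ.+ suc k) * Δ (suc k) P v + nat (suc k) * Δ k P v
      ≈⟨ +-cong (*-congˡ (Δ-pow m (suc k) v)) (*-congˡ (Δ-pow m k v)) ⟩
    nat (v ℕ.+ suc k) * nat (suc k ! ℕ.* a) + nat (suc k) * nat (k ! ℕ.* b)
      ≈⟨ +-cong (nat-* (v ℕ.+ suc k) (suc k ! ℕ.* a)) (nat-* (suc k) (k ! ℕ.* b)) ⟨
    nat ((v ℕ.+ suc k) ℕ.* (suc k ! ℕ.* a)) + nat (suc k ℕ.* (k ! ℕ.* b))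
      ≈⟨ nat-+ ((v ℕ.+ suc k) ℕ.* (suc k ! ℕ.* a)) (suc k ℕ.* (k ! ℕ.* b)) ⟨
    nat ((v ℕ.+ suc k) ℕ.* (suc k ! ℕ.* a) ℕ.+ suc k ℕ.* (k ! ℕ.* b))
      ≡⟨ ≡.cong nat (regroup (v ℕ.+ suc k) (suc k) (k !) a b) ⟩
    nat (suc k ! ℕ.* vStirling v (suc k) (suc m)) ∎
    where
    P = λ x → nat (x ℕ.^ m)
    a = vStirling v (suc k) m
    b = vStirling v k m
    regroup : ∀ c K f a b → c ℕ.* (K ℕ.* f ℕ.* a) ℕ.+ K ℕ.* (f ℕ.* b) ≡ K ℕ.* f ℕ.* (c ℕ.* a ℕ.+ b)
    regroup = solve-∀

  Δ-geometric : ∀ k x v → Δ k (x ^_) v ≈ (x - 1#) ^ k * x ^ v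
  Δ-geometric zero    x v = sym (*-identityˡ _)
  Δ-geometric (suc k) x v = begin
    Δ k (x ^_) (suc v) - Δ k (x ^_) v
      ≈⟨ +-cong (Δ-geometric k x (suc v)) (-‿cong (trans (Δ-geometric k x v) (sym (*-identityˡ _)))) ⟩
    (x - 1#) ^ k * (x * x ^ v) - 1# * ((x - 1#) ^ k * x ^ v)
      ≈⟨ solve 4 (λ o x y z → y :* (x :* z) :- o :* (y :* z) := (x :- o) :* y :* z) refl 1# x ((x - 1#) ^ k) (x ^ v) ⟩
    (x - 1#) ^ suc k * x ^ v ∎

  alternating-binomial : ∀ {j} n (u : ℕ → Carrier) → j ≤ n →
    Σ n (λ k → nat (j C k) * (sign k * u k)) ≈ sign j * Δ j u 0
  alternating-binomial {j} n u j≤n = begin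
    Σ n (λ k → nat (j C k) * (sign k * u k))
      ≈⟨ Σ-shrink n _ j≤n (λ k j<k → binomial-vanishes _ j<k) ⟩
    Σ j (λ k → nat (j C k) * (sign k * u k))
      ≈⟨ Σ-cong j (λ k k≤j → sym (factor-sign k k≤j)) ⟩
    Σ j (λ k → sign j * (nat (j C k) * (sign (j ∸ k) * u k)))
      ≈⟨ *-distribˡ-Σ j (sign j) _ ⟨
    sign j * Σ j (λ k → nat (j C k) * (sign (j ∸ k) * u k))
      ≈⟨ *-congˡ (Δ-newton j u 0) ⟨
    sign j * Δ j u 0 ∎
    where
    factor-sign : ∀ k → k ≤ j → sign j * (nat (j C k) * (sign (j ∸ k) * u k)) ≈ nat (j C k) * (sign k * u k)
    factor-sign k k≤j = trans
      (solve 4 (λ s c t x → s :* (c :* (t :* x)) := c :* (s :* t :* x)) refl (sign j) (nat (j C k)) (sign (j ∸ k)) (u k))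
      (*-congˡ (*-congʳ (sign-∸ k≤j)))

  binomial-expansion : ∀ {j} n x → j ≤ n → (1# - x) ^ j ≈ Σ n (λ k → nat (j C k) * (sign k * x ^ k))
  binomial-expansion {j} n x j≤n = begin
    (1# - x) ^ j              ≈⟨ ^-cong j (solve 2 (λ o x → o :- x := :- (x :- o)) refl 1# x) ⟩
    (- (x - 1#)) ^ j          ≈⟨ -‿^ (x - 1#) j ⟩
    sign j * (x - 1#) ^ j     ≈⟨ *-congˡ (trans (Δ-geometric j x 0) (*-identityʳ _)) ⟨
    sign j * Δ j (x ^_) 0     ≈⟨ alternating-binomial n (x ^_) j≤n ⟨
    Σ n (λ k → nat (j C k) * (sign k * x ^ k)) ∎

  alternating-binomial-reflected : ∀ {j} n (h : ℕ → Carrier) → j ≤ n →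
    Σ n (λ k → nat (j C k) * (sign k * h (n ∸ k))) ≈ Δ j h (n ∸ j)
  alternating-binomial-reflected {j} n h j≤n = begin
    Σ n (λ k → nat (j C k) * (sign k * h (n ∸ k)))
      ≈⟨ Σ-shrink n _ j≤n (λ k j<k → binomial-vanishes _ j<k) ⟩
    Σ j (λ k → nat (j C k) * (sign k * h (n ∸ k)))
      ≈⟨ Σ-reverse j _ ⟩
    Σ j (λ p → nat (j C (j ∸ p)) * (sign (j ∸ p) * h (n ∸ (j ∸ p))))
      ≈⟨ Σ-cong j (λ p p≤j → reflexive (≡.cong₂ (λ c t → nat c * (sign (j ∸ p) * h t))
                                         (≡.sym (nCk≡nC[n∸k] p≤j)) (m∸[n∸o]≡m∸n+o p≤j j≤n))) ⟩
    Σ j (λ p → nat (j C p) * (sign (j ∸ p) * h (n ∸ j ℕ.+ p)))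
      ≈⟨ Δ-newton j h (n ∸ j) ⟨
    Δ j h (n ∸ j) ∎

  nat-!*vStirling-vanishes : ∀ v {j m} → m < j → nat (j ! ℕ.* vStirling v j m) ≈ 0#
  nat-!*vStirling-vanishes v {j} m<j =
    reflexive (≡.cong nat (≡.trans (≡.cong (j ! ℕ.*_) (vStirling-vanishes v m<j)) (ℕₚ.*-zeroʳ (j !))))

  Δ-polynomial : ∀ n (a : ℕ → Carrier) → Δ n (λ i → Σ n (λ k → a k * nat i ^ k)) 0 ≈ a n * nat (n !)
  Δ-polynomial n a = begin
    Δ n (λ i → Σ n (λ k → a k * nat i ^ k)) 0
      ≈⟨ Δ-cong n (λ i → Σ-cong n (λ k _ → *-congˡ (nat-^ i k))) 0 ⟩
    Δ n (λ i → Σ n (λ k → a k * nat (i ℕ.^ k))) 0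
      ≈⟨ Δ-linear n n a (λ k i → nat (i ℕ.^ k)) 0 ⟩
    Σ n (λ k → a k * Δ n (λ i → nat (i ℕ.^ k)) 0)
      ≈⟨ Σ-cong n (λ k _ → *-congˡ (Δ-pow k n 0)) ⟩
    Σ n (λ k → a k * nat (n ! ℕ.* vStirling 0 n k))
      ≈⟨ Σ-last n _ (λ k k<n → trans (*-congˡ (nat-!*vStirling-vanishes 0 k<n)) (zeroʳ (a k))) ⟩
    a n * nat (n ! ℕ.* vStirling 0 n n)
      ≡⟨ ≡.cong (λ t → a n * nat (n ! ℕ.* t)) (vStirling-diagonal 0 n) ⟩
    a n * nat (n ! ℕ.* 1)
      ≡⟨ ≡.cong (λ t → a n * nat t) (ℕₚ.*-identityʳ (n !)) ⟩
    a n * nat (n !) ∎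

  Σ-binomial-expansion : ∀ n (g : ℕ → Carrier) x →
    Σ n (λ j → g j * (1# - x) ^ j) ≈ Σ n (λ k → Σ n (λ j → g j * (nat (j C k) * sign k)) * x ^ k)
  Σ-binomial-expansion n g x = begin
    Σ n (λ j → g j * (1# - x) ^ j)
      ≈⟨ Σ-cong n (λ j j≤n → *-congˡ (binomial-expansion n x j≤n)) ⟩
    Σ n (λ j → g j * Σ n (λ k → nat (j C k) * (sign k * x ^ k)))
      ≈⟨ Σ-cong n (λ j _ → *-distribˡ-Σ n (g j) _) ⟩
    Σ n (λ j → Σ n (λ k → g j * (nat (j C k) * (sign k * x ^ k))))
      ≈⟨ Σ-comm n n _ ⟩
    Σ n (λ k → Σ n (λ j → g j * (nat (j C k) * (sign k * x ^ k))))
      ≈⟨ Σ-cong n (λ k _ → Σ-cong n (λ j _ →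
           solve 4 (λ a c s y → a :* (c :* (s :* y)) := a :* (c :* s) :* y) refl (g j) (nat (j C k)) (sign k) (x ^ k))) ⟩
    Σ n (λ k → Σ n (λ j → g j * (nat (j C k) * sign k) * x ^ k))
      ≈⟨ Σ-cong n (λ k _ → *-distribʳ-Σ n (x ^ k) _) ⟨
    Σ n (λ k → Σ n (λ j → g j * (nat (j C k) * sign k)) * x ^ k) ∎

  BinomialPair : ℕ → (ℕ → Carrier) → (ℕ → Carrier) → Set (c Level.⊔ ℓ)
  BinomialPair n f g = ∀ x → Σ n (λ k → f k * x ^ k) ≈ Σ n (λ k → g k * (1# - x) ^ k)

  BinomialPair-sym : ∀ n {f g : ℕ → Carrier} → BinomialPair n f g → BinomialPair n g f
  BinomialPair-sym n hyp x = sym (trans (hyp (1# - x)) (Σ-cong n (λ k _ → *-congˡ (^-cong k 1-[1-x]≈x))))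
    where
    1-[1-x]≈x : 1# - (1# - x) ≈ x
    1-[1-x]≈x = solve 2 (λ o x → o :- (o :- x) := x) refl 1# x

  module _ (domain : IsIntegralDomain R) (char0 : HasCharZero R) where

    nat-!≉0 : ∀ n → ¬ nat (n !) ≈ 0#
    nat-!≉0 n = ≡.subst (λ t → ¬ nat t ≈ 0#) (ℕₚ.suc-pred (n !) {{n !≢0}}) (char0 (ℕ.pred (n !)))

    polynomial-leading-zero : ∀ n (a : ℕ → Carrier) → (∀ x → Σ n (λ k → a k * x ^ k) ≈ 0#) → a n ≈ 0#
    polynomial-leading-zero n a vanish
      with domain (a n) (nat (n !)) (trans (sym (Δ-polynomial n a)) (Δ-zero n (λ i → vanish (nat i)) 0))
    ... | inj₁ aₙ≈0  = aₙ≈0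
    ... | inj₂ n!≈0 = ⊥-elim (nat-!≉0 n n!≈0)

    polynomial-zero : ∀ n (a : ℕ → Carrier) → (∀ x → Σ n (λ k → a k * x ^ k) ≈ 0#) →
      ∀ {k} → k ≤ n → a k ≈ 0#
    polynomial-zero zero    a vanish z≤n = polynomial-leading-zero 0 a vanish
    polynomial-zero (suc n) a vanish k≤1+n with ℕₚ.m≤n⇒m<n∨m≡n k≤1+n
    ... | inj₂ ≡.refl   = polynomial-leading-zero (suc n) a vanish
    ... | inj₁ (s≤s k≤n) = polynomial-zero n a lower k≤n
      where
      lower : ∀ x → Σ n (λ k → a k * x ^ k) ≈ 0#
      lower x = begin
        Σ n (λ k → a k * x ^ k)                           ≈⟨ +-identityʳ _ ⟨
        Σ n (λ k → a k * x ^ k) + 0#                      ≈⟨ +-congˡ (trans (*-congʳ aₙ₊₁≈0) (zeroˡ _)) ⟨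
        Σ n (λ k → a k * x ^ k) + a (suc n) * x ^ suc n   ≈⟨ vanish x ⟩
        0#                                                ∎
        where aₙ₊₁≈0 = polynomial-leading-zero (suc n) a vanish

    polynomial-coefficients-unique : ∀ n (a b : ℕ → Carrier) →
      (∀ x → Σ n (λ k → a k * x ^ k) ≈ Σ n (λ k → b k * x ^ k)) → ∀ {k} → k ≤ n → a k ≈ b k
    polynomial-coefficients-unique n a b a≈b {k} k≤n =
      x∙y⁻¹≈ε⇒x≈y (a k) (b k) (polynomial-zero n (λ k → a k - b k) difference k≤n)
      where
      difference : ∀ x → Σ n (λ k → (a k - b k) * x ^ k) ≈ 0#
      difference x = begin
        Σ n (λ k → (a k - b k) * x ^ k)                   ≈⟨ Σ-cong n (λ k _ → [y-z]x≈yx-zx (x ^ k) (a k) (b k)) ⟩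
        Σ n (λ k → a k * x ^ k - b k * x ^ k)             ≈⟨ Σ-distrib-sub n _ _ ⟩
        Σ n (λ k → a k * x ^ k) - Σ n (λ k → b k * x ^ k) ≈⟨ +-congʳ (a≈b x) ⟩
        Σ n (λ k → b k * x ^ k) - Σ n (λ k → b k * x ^ k) ≈⟨ -‿inverseʳ _ ⟩
        0#                                                ∎

    moment-transfer : ∀ n (f g : ℕ → Carrier) → BinomialPair n f g →
      ∀ (u : ℕ → Carrier) → Σ n (λ k → u k * f k) ≈ Σ n (λ j → g j * Σ n (λ k → nat (j C k) * (sign k * u k)))
    moment-transfer n f g hyp u = begin
      Σ n (λ k → u k * f k)
        ≈⟨ Σ-cong n (λ k k≤n → *-congˡ (polynomial-coefficients-unique n f _ expansion k≤n)) ⟩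
      Σ n (λ k → u k * Σ n (λ j → g j * (nat (j C k) * sign k)))
        ≈⟨ Σ-cong n (λ k _ → *-distribˡ-Σ n (u k) _) ⟩
      Σ n (λ k → Σ n (λ j → u k * (g j * (nat (j C k) * sign k))))
        ≈⟨ Σ-comm n n _ ⟩
      Σ n (λ j → Σ n (λ k → u k * (g j * (nat (j C k) * sign k))))
        ≈⟨ Σ-cong n (λ j _ → Σ-cong n (λ k _ →
             solve 4 (λ y a c s → y :* (a :* (c :* s)) := a :* (c :* (s :* y))) refl (u k) (g j) (nat (j C k)) (sign k))) ⟩
      Σ n (λ j → Σ n (λ k → g j * (nat (j C k) * (sign k * u k))))
        ≈⟨ Σ-cong n (λ j _ → *-distribˡ-Σ n (g j) _) ⟨
      Σ n (λ j → g j * Σ n (λ k → nat (j C k) * (sign k * u k))) ∎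
      where
      expansion : ∀ x → Σ n (λ k → f k * x ^ k) ≈ Σ n (λ k → Σ n (λ j → g j * (nat (j C k) * sign k)) * x ^ k)
      expansion x = trans (hyp x) (Σ-binomial-expansion n g x)

module IntegerInstance where
  open CommutativeRingLemmas ℤₚ.+-*-commutativeRing
  open ≡.≡-Reasoning

  nat≡+ : ∀ n → nat n ≡ + n
  nat≡+ zero    = ≡.refl
  nat≡+ (suc n) = ≡.cong (ℤ._+_ (+ 1)) (nat≡+ n)

  sign≡sgn : ∀ j → sign j ≡ sgn j
  sign≡sgn zero    = ≡.refl
  sign≡sgn (suc j) = ≡.cong ℤ.-_ (sign≡sgn j)

  ℤsum≡Σ : ∀ k h → ℤsum k h ≡ Σ k h
  ℤsum≡Σ zero    h = ≡.refl
  ℤsum≡Σ (suc k) h = ≡.cong (ℤ._+ h (suc k)) (ℤsum≡Σ k h)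

  -- The division by u! in vStirling2 is exact: the sum it divides is Δᵘ(xᵐ)(v) = u!·{m+v, u+v}_v.
  vStirling2≡vStirling : ∀ v u m → vStirling2 v u m ≡ + vStirling v u m
  vStirling2≡vStirling v u m = begin
    (ℤsum u terms ℤ./ℕ u !) {{u !≢0}}
      ≡⟨ ≡.cong (λ z → (z ℤ./ℕ u !) {{u !≢0}}) newton ⟩
    + ((u ! ℕ.* vStirling v u m) ℕ./ u !) {{u !≢0}}
      ≡⟨ ≡.cong (λ t → + (t ℕ./ u !) {{u !≢0}}) (ℕₚ.*-comm (u !) _) ⟩
    + ((vStirling v u m ℕ.* u !) ℕ./ u !) {{u !≢0}}
      ≡⟨ ≡.cong +_ (m*n/n≡m (vStirling v u m) (u !) {{u !≢0}}) ⟩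
    + vStirling v u m ∎
    where
    terms : ℕ → ℤ
    terms p = sgn (u ∸ p) ℤ.* + (u C p) ℤ.* + ((v ℕ.+ p) ℕ.^ m)
    reorder : ∀ p → terms p ≡ nat (u C p) ℤ.* (sign (u ∸ p) ℤ.* nat ((v ℕ.+ p) ℕ.^ m))
    reorder p rewrite nat≡+ (u C p) | nat≡+ ((v ℕ.+ p) ℕ.^ m) | sign≡sgn (u ∸ p) =
      ≡.trans (≡.cong (ℤ._* + ((v ℕ.+ p) ℕ.^ m)) (ℤₚ.*-comm (sgn (u ∸ p)) (+ (u C p))))
        (ℤₚ.*-assoc (+ (u C p)) (sgn (u ∸ p)) (+ ((v ℕ.+ p) ℕ.^ m)))
    newton : ℤsum u terms ≡ + (u ! ℕ.* vStirling v u m)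
    newton = begin
      ℤsum u terms                                                    ≡⟨ ℤsum≡Σ u terms ⟩
      Σ u terms                                                       ≡⟨ Σ-cong u (λ p _ → reorder p) ⟩
      Σ u (λ p → nat (u C p) ℤ.* (sign (u ∸ p) ℤ.* nat ((v ℕ.+ p) ℕ.^ m)))
        ≡⟨ Δ-newton u (λ x → nat (x ℕ.^ m)) v ⟨
      Δ u (λ x → nat (x ℕ.^ m)) v                                     ≡⟨ Δ-pow m u v ⟩
      nat (u ! ℕ.* vStirling v u m)                                   ≡⟨ nat≡+ _ ⟩
      + (u ! ℕ.* vStirling v u m)                                     ∎

open IntegerInstance using (vStirling2≡vStirling)

module Moments {c ℓ : Level} (R : CommutativeRing c ℓ) (domain : IsIntegralDomain R) (char0 : HasCharZero R)
  (n : ℕ) (f g : ℕ → CommutativeRing.Carrier R) (hyp : CommutativeRingLemmas.BinomialPair R n f g) (m : ℕ) where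
  open CommutativeRing R
  open CommutativeRingLemmas R
  open import Relation.Binary.Reasoning.Setoid setoid

  stirling-moment :
    Σ n (λ k → ι (+ (k ℕ.^ m)) * f k) ≈ Σ (m ⊓ n) (λ k → ι (sgn k ℤ.* + (k !) ℤ.* stirling2 m k) * g k)
  stirling-moment = begin
    Σ n (λ k → nat (k ℕ.^ m) * f k)
      ≈⟨ moment-transfer domain char0 n f g hyp _ ⟩
    Σ n (λ j → g j * Σ n (λ k → nat (j C k) * (sign k * nat (k ℕ.^ m))))
      ≈⟨ Σ-cong n (λ j j≤n → *-congˡ (trans (alternating-binomial n _ j≤n) (*-congˡ (Δ-pow m j 0)))) ⟩
    Σ n (λ j → g j * (sign j * nat (j ! ℕ.* vStirling 0 j m)))
      ≈⟨ Σ-⊓ m n _ (λ j m<j → trans (*-congˡ (trans (*-congˡ (nat-!*vStirling-vanishes 0 m<j)) (zeroʳ _)))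
                                    (zeroʳ _)) ⟩
    Σ (m ⊓ n) (λ j → g j * (sign j * nat (j ! ℕ.* vStirling 0 j m)))
      ≈⟨ Σ-cong (m ⊓ n) (λ j _ → trans (*-comm _ _) (*-congʳ (coefficient j))) ⟩
    Σ (m ⊓ n) (λ j → ι (sgn j ℤ.* + (j !) ℤ.* stirling2 m j) * g j) ∎
    where
    coefficient : ∀ j → sign j * nat (j ! ℕ.* vStirling 0 j m) ≈ ι (sgn j ℤ.* + (j !) ℤ.* stirling2 m j)
    coefficient j = begin
      sign j * nat (j ! ℕ.* vStirling 0 j m)                ≈⟨ *-congˡ (nat-* (j !) _) ⟩
      sign j * (nat (j !) * nat (vStirling 0 j m))          ≈⟨ *-assoc _ _ _ ⟨
      sign j * nat (j !) * nat (vStirling 0 j m)            ≈⟨ *-congʳ (*-congʳ (ι-sgn j)) ⟨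
      ι (sgn j) * ι (+ (j !)) * ι (+ vStirling 0 j m)       ≈⟨ *-congʳ (ι-* (sgn j) (+ (j !))) ⟨
      ι (sgn j ℤ.* + (j !)) * ι (+ vStirling 0 j m)         ≈⟨ ι-* (sgn j ℤ.* + (j !)) _ ⟨
      ι (sgn j ℤ.* + (j !) ℤ.* + vStirling 0 j m)
        ≡⟨ ≡.cong (λ s → ι (sgn j ℤ.* + (j !) ℤ.* s)) (vStirling2≡vStirling 0 j m) ⟨
      ι (sgn j ℤ.* + (j !) ℤ.* stirling2 m j)               ∎

  reflected-moment :
    Σ n (λ k → ι (+ (k ℕ.^ m)) * f (n ∸ k)) ≈ Σ (m ⊓ n) (λ k → ι (+ (k !) ℤ.* vStirling2 (n ∸ k) k m) * g k)
  reflected-moment = begin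
    Σ n (λ k → nat (k ℕ.^ m) * f (n ∸ k))
      ≈⟨ Σ-cong n (λ k k≤n → reflexive (≡.cong (λ t → nat (t ℕ.^ m) * f (n ∸ k)) (ℕₚ.m∸[m∸n]≡n k≤n))) ⟨
    Σ n (λ k → nat ((n ∸ (n ∸ k)) ℕ.^ m) * f (n ∸ k))
      ≈⟨ Σ-reverse n (λ k → nat ((n ∸ k) ℕ.^ m) * f k) ⟨
    Σ n (λ k → nat ((n ∸ k) ℕ.^ m) * f k)
      ≈⟨ moment-transfer domain char0 n f g hyp _ ⟩
    Σ n (λ j → g j * Σ n (λ k → nat (j C k) * (sign k * nat ((n ∸ k) ℕ.^ m))))
      ≈⟨ Σ-cong n (λ j j≤n → *-congˡ (trans (alternating-binomial-reflected n _ j≤n) (Δ-pow m j (n ∸ j)))) ⟩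
    Σ n (λ j → g j * nat (j ! ℕ.* vStirling (n ∸ j) j m))
      ≈⟨ Σ-⊓ m n _ (λ j m<j → trans (*-congˡ (nat-!*vStirling-vanishes (n ∸ j) m<j)) (zeroʳ _)) ⟩
    Σ (m ⊓ n) (λ j → g j * nat (j ! ℕ.* vStirling (n ∸ j) j m))
      ≈⟨ Σ-cong (m ⊓ n) (λ j _ → trans (*-comm _ _) (*-congʳ (coefficient j))) ⟩
    Σ (m ⊓ n) (λ j → ι (+ (j !) ℤ.* vStirling2 (n ∸ j) j m) * g j) ∎
    where
    coefficient : ∀ j → nat (j ! ℕ.* vStirling (n ∸ j) j m) ≈ ι (+ (j !) ℤ.* vStirling2 (n ∸ j) j m)
    coefficient j = begin
      nat (j ! ℕ.* vStirling (n ∸ j) j m)           ≈⟨ nat-* (j !) _ ⟩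
      ι (+ (j !)) * ι (+ vStirling (n ∸ j) j m)     ≈⟨ ι-* (+ (j !)) _ ⟨
      ι (+ (j !) ℤ.* + vStirling (n ∸ j) j m)
        ≡⟨ ≡.cong (λ s → ι (+ (j !) ℤ.* s)) (vStirling2≡vStirling (n ∸ j) j m) ⟨
      ι (+ (j !) ℤ.* vStirling2 (n ∸ j) j m)        ∎

theorem7 : {c ℓ : Level} (R : CommutativeRing c ℓ) →
    IsIntegralDomain R → HasCharZero R →
    (n : ℕ) (f g : ℕ → CommutativeRing.Carrier R) →
    (∀ x → CommutativeRing._≈_ R
        (rsum R n (λ k → CommutativeRing._*_ R (f k) (rpow R x k)))
        (rsum R n (λ k → CommutativeRing._*_ R (g k)
          (rpow R
            (CommutativeRing._+_ R (CommutativeRing.1# R) (CommutativeRing.-_ R x)) k)))) →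
    (m : ℕ) →
      CommutativeRing._≈_ R
        (rsum R n (λ k → CommutativeRing._*_ R (ιℤ R (+ (Data.Nat._^_ k m))) (f k)))
        (rsum R (m ⊓ n) (λ k → CommutativeRing._*_ R
          (ιℤ R (sgn k ℤ.* (+ (k !)) ℤ.* stirling2 m k)) (g k)))
    × CommutativeRing._≈_ R
        (rsum R n (λ k → CommutativeRing._*_ R (ιℤ R (+ (Data.Nat._^_ k m))) (g k)))
        (rsum R (m ⊓ n) (λ k → CommutativeRing._*_ R
          (ιℤ R (sgn k ℤ.* (+ (k !)) ℤ.* stirling2 m k)) (f k)))
    × CommutativeRing._≈_ R
        (rsum R n (λ k → CommutativeRing._*_ R (ιℤ R (+ (Data.Nat._^_ k m))) (f (n ∸ k))))
        (rsum R (m ⊓ n) (λ k → CommutativeRing._*_ R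
          (ιℤ R ((+ (k !)) ℤ.* vStirling2 (n ∸ k) k m)) (g k)))
    × CommutativeRing._≈_ R
        (rsum R n (λ k → CommutativeRing._*_ R (ιℤ R (+ (Data.Nat._^_ k m))) (g (n ∸ k))))
        (rsum R (m ⊓ n) (λ k → CommutativeRing._*_ R
          (ιℤ R ((+ (k !)) ℤ.* vStirling2 (n ∸ k) k m)) (f k)))
theorem7 R domain char0 n f g hyp m =
  F.stirling-moment , G.stirling-moment , F.reflected-moment , G.reflected-moment
  where
  module F = Moments R domain char0 n f g hyp m
  module G = Moments R domain char0 n g f (CommutativeRingLemmas.BinomialPair-sym R n hyp) m
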